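{- Let $\mathcal{C}\subseteq\omega^\omega$ be non-empty and upwards closed under Turing reducibility, let $\mathcal{E}_i\subseteq\omega^\omega$ for $i\in\omega$, and suppose $\bigcup_{i\in\omega}i^\frown\mathcal{E}_i\le_{\mathcal{M}}\mathcal{C}$. Then there is an $i\in\omega$ such that $\mathcal{E}_i\le_{\mathcal{M}}\mathcal{C}$.
   Context: For $i\in\omega$ and $f\in\omega^\omega$, $i^\frown f$ is the function with first value $i$ followed by $f$, and $i^\frown\mathcal{E}=\{i^\frown f:f\in\mathcal{E}\}$. Medvedev reducibility: $\mathcal{A}\le_{\mathcal{M}}\mathcal{B}$ iff there is a partial Turing functional $\Phi$ with $\Phi(\mathcal{B})\subseteq\mathcal{A}$ (i.e. $\Phi(g)$ is total and in $\mathcal{A}$ for every $g\in\mathcal{B}$). $\mathcal{C}$ upwards closed under Turing reducibility means $g\in\mathcal{C}$ and $g\le_T h$ imply $h\in\mathcal{C}$. -}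

module Defs where

open import Data.Nat using (ℕ; zero; suc; _<_)
open import Data.Fin using (Fin)
open import Data.Vec using (Vec; []; _∷_; lookup)
open import Data.Product using (Σ; ∃; _×_; _,_)
open import Relation.Binary.PropositionalEquality using (_≡_)

Baire : Set
Baire = ℕ → ℕ

Subset : Set₁
Subset = Baire → Set

-- Codes of partial recursive functions (Kleene's μ-recursive functions)
-- of arity n, relative to an oracle.  Code 1 = partial Turing functionals.
data Code : ℕ → Set where
  zer  : ∀ {n} → Code n
  succ : Code 1
  proj : ∀ {n} → Fin n → Code n
  orac : Code 1
  comp : ∀ {m n} → Code m → Vec (Code n) m → Code n
  prec : ∀ {n} → Code n → Code (suc (suc n)) → Code (suc n)
  mu   : ∀ {n} → Code (suc n) → Code n

-- Big-step semantics with oracle g: Eval g e xs y  means  e^g(xs)↓ = y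
mutual
  data Eval (g : Baire) : ∀ {n} → Code n → Vec ℕ n → ℕ → Set where
    ev-zer  : ∀ {n} {xs : Vec ℕ n} → Eval g zer xs 0
    ev-succ : ∀ {x} → Eval g succ (x ∷ []) (suc x)
    ev-proj : ∀ {n} {i : Fin n} {xs} → Eval g (proj i) xs (lookup xs i)
    ev-orac : ∀ {x} → Eval g orac (x ∷ []) (g x)
    ev-comp : ∀ {m n} {f : Code m} {hs : Vec (Code n) m} {xs ys y} →
              EvalVec g hs xs ys → Eval g f ys y → Eval g (comp f hs) xs y
    ev-prec0 : ∀ {n} {f : Code n} {h xs y} →
              Eval g f xs y → Eval g (prec f h) (0 ∷ xs) y
    ev-precS : ∀ {n} {f : Code n} {h xs k r y} →
              Eval g (prec f h) (k ∷ xs) r → Eval g h (k ∷ r ∷ xs) y →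
              Eval g (prec f h) (suc k ∷ xs) y
    ev-mu   : ∀ {n} {f : Code (suc n)} {xs y} →
              Eval g f (y ∷ xs) 0 →
              (∀ z → z < y → Σ ℕ (λ k → Eval g f (z ∷ xs) (suc k))) →
              Eval g (mu f) xs y

  data EvalVec (g : Baire) {n : ℕ} : ∀ {m} → Vec (Code n) m → Vec ℕ n → Vec ℕ m → Set where
    evv-[] : ∀ {xs} → EvalVec g [] xs []
    evv-∷  : ∀ {m} {h : Code n} {hs : Vec (Code n) m} {xs y ys} →
             Eval g h xs y → EvalVec g hs xs ys → EvalVec g (h ∷ hs) xs (y ∷ ys)

Computes : Code 1 → Baire → Baire → Set
Computes e g f = ∀ n → Eval g e (n ∷ []) (f n)

_≤T_ : Baire → Baire → Set
f ≤T g = ∃ λ (e : Code 1) → Computes e g f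

_≤M_ : Subset → Subset → Set
A ≤M B = ∃ λ (e : Code 1) → ∀ g → B g → Σ Baire (λ f → Computes e g f × A f)

UpwardClosed : Subset → Set
UpwardClosed C = ∀ g h → C g → g ≤T h → C h

tail : Baire → Baire
tail f n = f (suc n)

⋃cons : (ℕ → Subset) → Subset
⋃cons E f = Σ ℕ (λ i → (f 0 ≡ i) × E i (tail f))

-- Φ(g₀)(0) = i converges for some g₀ ∈ C, and by the use principle it only
-- queries a finite prefix σ of g₀. For h ∈ C the function σ⁀h computes h, so it
-- lies in C; hence Φ(σ⁀h) ∈ ⋃ i⁀Eᵢ, and it begins with the same i since σ⁀h
-- agrees with g₀ on the use. So h ↦ tail Φ(σ⁀h) is a uniform reduction of Eᵢ to C.
module Submission where

open import Defs
open import Data.Nat using (ℕ; zero; suc; _+_; _<_; _≤_; _⊔_; s≤s)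
open import Data.Nat.Properties
  using (<-cmp; m≤m⊔n; m≤n⊔m; ≤-refl; n≤1+n; <-≤-trans; m<1+n⇒m<n∨m≡n)
open import Data.Fin using () renaming (zero to fzero)
open import Data.Vec using (Vec; []; _∷_)
open import Data.List using (List; []; _∷_; length)
open import Data.Product using (Σ; _,_; proj₁; proj₂; _×_)
open import Data.Sum using (inj₁; inj₂)
open import Relation.Binary using (tri<; tri≈; tri>)
open import Relation.Binary.PropositionalEquality
  using (_≡_; refl; sym; trans; subst)

mutual
  eval-deterministic : ∀ {g n} {e : Code n} {xs y y′} →
                       Eval g e xs y → Eval g e xs y′ → y ≡ y′
  eval-deterministic ev-zer ev-zer = refl
  eval-deterministic ev-succ ev-succ = refl
  eval-deterministic ev-proj ev-proj = refl
  eval-deterministic ev-orac ev-orac = refl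
  eval-deterministic (ev-comp hs f) (ev-comp hs′ f′)
    with evalVec-deterministic hs hs′
  ... | refl = eval-deterministic f f′
  eval-deterministic (ev-prec0 f) (ev-prec0 f′) = eval-deterministic f f′
  eval-deterministic (ev-precS r h) (ev-precS r′ h′)
    with eval-deterministic r r′
  ... | refl = eval-deterministic h h′
  eval-deterministic (ev-mu {y = y} zero-at-y below) (ev-mu {y = y′} zero-at-y′ below′)
    with <-cmp y y′
  ... | tri≈ _ y≡y′ _ = y≡y′
  ... | tri< y<y′ _ _ with eval-deterministic zero-at-y (proj₂ (below′ y y<y′))
  ...   | ()
  eval-deterministic (ev-mu {y = y} zero-at-y below) (ev-mu {y = y′} zero-at-y′ below′)
      | tri> _ _ y′<y with eval-deterministic (proj₂ (below y′ y′<y)) zero-at-y′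
  ...   | ()

  evalVec-deterministic : ∀ {g n m} {hs : Vec (Code n) m} {xs ys ys′} →
                          EvalVec g hs xs ys → EvalVec g hs xs ys′ → ys ≡ ys′
  evalVec-deterministic evv-[] evv-[] = refl
  evalVec-deterministic (evv-∷ h hs) (evv-∷ h′ hs′)
    with eval-deterministic h h′ | evalVec-deterministic hs hs′
  ... | refl | refl = refl

common-bound : {P : ℕ → ℕ → Set} → (∀ {z N M} → N ≤ M → P z N → P z M) →
               ∀ y → (∀ z → z < y → Σ ℕ (P z)) → Σ ℕ (λ N → ∀ z → z < y → P z N)
common-bound mono zero bounds = 0 , λ _ ()
common-bound {P} mono (suc y) bounds
  with common-bound {P} mono y (λ z z<y → bounds z (<-≤-trans z<y (n≤1+n y)))
     | bounds y ≤-refl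
... | N , below-y | M , at-y = N ⊔ M , below-suc-y
  where
  below-suc-y : ∀ z → z < suc y → P z (N ⊔ M)
  below-suc-y z z<1+y with m<1+n⇒m<n∨m≡n z<1+y
  ... | inj₁ z<y  = mono (m≤m⊔n N M) (below-y z z<y)
  ... | inj₂ refl = mono (m≤n⊔m N M) at-y

Agree : ℕ → Baire → Baire → Set
Agree N g h = ∀ x → x < N → g x ≡ h x

Agree-≤ : ∀ {g h N M} → N ≤ M → Agree M g h → Agree N g h
Agree-≤ N≤M agree x x<N = agree x (<-≤-trans x<N N≤M)

Stable : Baire → ∀ {n} → Code n → Vec ℕ n → ℕ → ℕ → Set
Stable g e xs y N = ∀ h → Agree N g h → Eval h e xs y

StableVec : Baire → ∀ {n m} → Vec (Code n) m → Vec ℕ n → Vec ℕ m → ℕ → Set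
StableVec g hs xs ys N = ∀ h → Agree N g h → EvalVec h hs xs ys

Stable-≤ : ∀ {g n} {e : Code n} {xs y N M} → N ≤ M → Stable g e xs y N → Stable g e xs y M
Stable-≤ N≤M stable h agree = stable h (Agree-≤ N≤M agree)

StableVec-≤ : ∀ {g n m} {hs : Vec (Code n) m} {xs ys N M} →
              N ≤ M → StableVec g hs xs ys N → StableVec g hs xs ys M
StableVec-≤ N≤M stable h agree = stable h (Agree-≤ N≤M agree)

mutual
  eval-use : ∀ {g n} {e : Code n} {xs y} → Eval g e xs y → Σ ℕ (Stable g e xs y)
  eval-use ev-zer = 0 , λ _ _ → ev-zer
  eval-use ev-succ = 0 , λ _ _ → ev-succ
  eval-use ev-proj = 0 , λ _ _ → ev-proj
  eval-use (ev-orac {x}) =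
    suc x , λ h agree → subst (Eval h orac (x ∷ [])) (sym (agree x ≤-refl)) ev-orac
  eval-use (ev-comp hs f) with evalVec-use hs | eval-use f
  ... | N , hs-stable | M , f-stable = N ⊔ M , λ h agree →
    ev-comp (StableVec-≤ (m≤m⊔n N M) hs-stable h agree)
            (Stable-≤ (m≤n⊔m N M) f-stable h agree)
  eval-use (ev-prec0 f) with eval-use f
  ... | N , f-stable = N , λ h agree → ev-prec0 (f-stable h agree)
  eval-use (ev-precS r s) with eval-use r | eval-use s
  ... | N , r-stable | M , s-stable = N ⊔ M , λ h agree →
    ev-precS (Stable-≤ (m≤m⊔n N M) r-stable h agree)
             (Stable-≤ (m≤n⊔m N M) s-stable h agree)
  eval-use {g} {e = mu f} {xs} (ev-mu {y = y} zero-at-y below) with eval-use zero-at-y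
  ... | N , zero-stable = N ⊔ M , λ h agree →
    ev-mu (Stable-≤ (m≤m⊔n N M) zero-stable h agree)
          (λ z z<y → proj₁ (below-stable z z<y)
                   , Stable-≤ (m≤n⊔m N M) (proj₂ (below-stable z z<y)) h agree)
    where
    StablyPositive : ℕ → ℕ → Set
    StablyPositive z N = Σ ℕ (λ k → Stable g f (z ∷ xs) (suc k) N)

    bounds : ∀ z → z < y → Σ ℕ (StablyPositive z)
    bounds z z<y with below z z<y
    ... | k , positive with eval-use positive
    ...   | N , stable = N , k , stable

    below-bound : Σ ℕ (λ M → ∀ z → z < y → StablyPositive z M)
    below-bound = common-bound (λ { N≤M (k , stable) → k , Stable-≤ N≤M stable }) y bounds

    M = proj₁ below-bound
    below-stable = proj₂ below-bound

  evalVec-use : ∀ {g n m} {hs : Vec (Code n) m} {xs ys} →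
                EvalVec g hs xs ys → Σ ℕ (StableVec g hs xs ys)
  evalVec-use evv-[] = 0 , λ _ _ → evv-[]
  evalVec-use (evv-∷ h hs) with eval-use h | evalVec-use hs
  ... | N , h-stable | M , hs-stable = N ⊔ M , λ g agree →
    evv-∷ (Stable-≤ (m≤m⊔n N M) h-stable g agree)
          (StableVec-≤ (m≤n⊔m N M) hs-stable g agree)

mutual
  _∘ᶜ_ : ∀ {n} → Code n → Code 1 → Code n
  zer ∘ᶜ c = zer
  succ ∘ᶜ c = succ
  proj i ∘ᶜ c = proj i
  orac ∘ᶜ c = c
  comp f hs ∘ᶜ c = comp (f ∘ᶜ c) (hs ∘ᶜᵛ c)
  prec f h ∘ᶜ c = prec (f ∘ᶜ c) (h ∘ᶜ c)
  mu f ∘ᶜ c = mu (f ∘ᶜ c)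

  _∘ᶜᵛ_ : ∀ {n m} → Vec (Code n) m → Code 1 → Vec (Code n) m
  [] ∘ᶜᵛ c = []
  (h ∷ hs) ∘ᶜᵛ c = (h ∘ᶜ c) ∷ (hs ∘ᶜᵛ c)

mutual
  eval-∘ᶜ : ∀ {g h n} {e : Code n} {xs y} c →
            Computes c h g → Eval g e xs y → Eval h (e ∘ᶜ c) xs y
  eval-∘ᶜ c c-h≡g ev-zer = ev-zer
  eval-∘ᶜ c c-h≡g ev-succ = ev-succ
  eval-∘ᶜ c c-h≡g ev-proj = ev-proj
  eval-∘ᶜ c c-h≡g (ev-orac {x}) = c-h≡g x
  eval-∘ᶜ c c-h≡g (ev-comp hs f) = ev-comp (evalVec-∘ᶜ c c-h≡g hs) (eval-∘ᶜ c c-h≡g f)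
  eval-∘ᶜ c c-h≡g (ev-prec0 f) = ev-prec0 (eval-∘ᶜ c c-h≡g f)
  eval-∘ᶜ c c-h≡g (ev-precS r s) = ev-precS (eval-∘ᶜ c c-h≡g r) (eval-∘ᶜ c c-h≡g s)
  eval-∘ᶜ c c-h≡g (ev-mu zero-at-y below) =
    ev-mu (eval-∘ᶜ c c-h≡g zero-at-y)
          (λ z z<y → proj₁ (below z z<y) , eval-∘ᶜ c c-h≡g (proj₂ (below z z<y)))

  evalVec-∘ᶜ : ∀ {g h n m} {hs : Vec (Code n) m} {xs ys} c →
               Computes c h g → EvalVec g hs xs ys → EvalVec h (hs ∘ᶜᵛ c) xs ys
  evalVec-∘ᶜ c c-h≡g evv-[] = evv-[]
  evalVec-∘ᶜ c c-h≡g (evv-∷ h hs) = evv-∷ (eval-∘ᶜ c c-h≡g h) (evalVec-∘ᶜ c c-h≡g hs)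

computes-∘ᶜ : ∀ {h g f} e c → Computes c h g → Computes e g f → Computes (e ∘ᶜ c) h f
computes-∘ᶜ e c c-h≡g e-g≡f n = eval-∘ᶜ c c-h≡g (e-g≡f n)

numeral : ℕ → Code 0
numeral zero = zer
numeral (suc a) = comp succ (numeral a ∷ [])

eval-numeral : ∀ {g} a → Eval g (numeral a) [] a
eval-numeral zero = ev-zer
eval-numeral (suc a) = ev-comp (evv-∷ (eval-numeral a) evv-[]) ev-succ

addCode : ℕ → Code 1
addCode zero = proj fzero
addCode (suc k) = comp succ (addCode k ∷ [])

eval-addCode : ∀ {g} k n → Eval g (addCode k) (n ∷ []) (k + n)
eval-addCode zero n = ev-proj
eval-addCode (suc k) n = ev-comp (evv-∷ (eval-addCode k n) evv-[]) ev-succ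

drop : ℕ → Baire → Baire
drop k g n = g (k + n)

dropCode : ℕ → Code 1
dropCode k = comp orac (addCode k ∷ [])

computes-drop : ∀ k g → Computes (dropCode k) g (drop k g)
computes-drop k g n = ev-comp (evv-∷ (eval-addCode k n) evv-[]) ev-orac

_++ᴮ_ : List ℕ → Baire → Baire
([] ++ᴮ h) x = h x
((a ∷ σ) ++ᴮ h) zero = a
((a ∷ σ) ++ᴮ h) (suc x) = (σ ++ᴮ h) x

drop-++ᴮ : ∀ σ h n → drop (length σ) (σ ++ᴮ h) n ≡ h n
drop-++ᴮ [] h n = refl
drop-++ᴮ (a ∷ σ) h n = drop-++ᴮ σ h n

≤T-++ᴮ : ∀ σ h → h ≤T (σ ++ᴮ h)
≤T-++ᴮ σ h = dropCode (length σ) , λ n →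
  subst (Eval (σ ++ᴮ h) (dropCode (length σ)) (n ∷ []))
        (drop-++ᴮ σ h n) (computes-drop (length σ) (σ ++ᴮ h) n)

prependCode : List ℕ → Code 1
prependCode [] = orac
prependCode (a ∷ σ) = prec (numeral a) (comp (prependCode σ) (proj fzero ∷ []))

computes-prepend : ∀ σ h → Computes (prependCode σ) h (σ ++ᴮ h)
computes-prepend [] h x = ev-orac
computes-prepend (a ∷ σ) h zero = ev-prec0 (eval-numeral a)
computes-prepend (a ∷ σ) h (suc x) =
  ev-precS (computes-prepend (a ∷ σ) h x)
           (ev-comp (evv-∷ ev-proj evv-[]) (computes-prepend σ h x))

take : ℕ → Baire → List ℕ
take zero g = []
take (suc N) g = g 0 ∷ take N (tail g)

Agree-take-++ᴮ : ∀ N g h → Agree N g (take N g ++ᴮ h)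
Agree-take-++ᴮ (suc N) g h zero _ = refl
Agree-take-++ᴮ (suc N) g h (suc x) (s≤s x<N) = Agree-take-++ᴮ N (tail g) h x x<N

lemma7p5 : (C : Subset) (E : ℕ → Subset) →
           Σ Baire C → UpwardClosed C → ⋃cons E ≤M C →
           Σ ℕ (λ i → E i ≤M C)
lemma7p5 C E (g₀ , g₀∈C) C-upward (e , reduce) with reduce g₀ g₀∈C
... | f₀ , e-g₀≡f₀ , _ with eval-use (e-g₀≡f₀ 0)
... | N , head-stable = f₀ 0 , Ψ , reduce-Eᵢ
  where
  σ : List ℕ
  σ = take N g₀

  Ψ : Code 1
  Ψ = dropCode 1 ∘ᶜ (e ∘ᶜ prependCode σ)

  reduce-Eᵢ : ∀ h → C h → Σ Baire (λ f → Computes Ψ h f × E (f₀ 0) f)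
  reduce-Eᵢ h h∈C with reduce (σ ++ᴮ h) (C-upward h (σ ++ᴮ h) h∈C (≤T-++ᴮ σ h))
  ... | f , e-σh≡f , j , f0≡j , tail-f∈Eⱼ =
    tail f , computes-∘ᶜ (dropCode 1) (e ∘ᶜ prependCode σ)
               (computes-∘ᶜ e (prependCode σ) (computes-prepend σ h) e-σh≡f)
               (computes-drop 1 f)
           , subst (λ i → E i (tail f)) (trans (sym f0≡j) (sym same-head)) tail-f∈Eⱼ
    where
    same-head : f₀ 0 ≡ f 0
    same-head = eval-deterministic (head-stable (σ ++ᴮ h) (Agree-take-++ᴮ N g₀ h)) (e-σh≡f 0)
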